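{- Every threshold graph satisfies the full Brouwer property.
   Context: All graphs are finite, simple and undirected; $e(H)$ is the number of edges. For a graph $H$ on $N$ vertices, $L(H)=D(H)-A(H)$ is its Laplacian matrix with eigenvalues $\mu_1(H)\ge\dots\ge\mu_N(H)$, and $s_k(H)=\sum_{i=1}^k\mu_i(H)$, with the convention $s_0(H)=0$ and $\binom{1}{2}=0$. A threshold graph is a graph built from a single vertex by repeatedly adding a new isolated vertex or a new dominating vertex (adjacent to all previous vertices). We say $H$ satisfies the full Brouwer property if for each $k\in\{0,1,\dots,N-1\}$, $s_k(H)\le e(H)+\binom{k+1}{2}$, with equality if and only if $H$ is a threshold graph on $N$ vertices with clique number $k+1$. -}

module Defs where

open import Data.Bool using (Bool; true; false; if_then_else_)
open import Data.Nat as ℕ using (ℕ; zero; suc; _<ᵇ_)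
open import Data.Nat.Combinatorics using (_C_)
open import Data.Integer as ℤ using (ℤ; +_; -_)
open import Data.Fin using (Fin; toℕ)
open import Data.Fin.Properties using (_≟_)
open import Data.Product using (Σ; ∃; _×_; _,_)
open import Function.Definitions using (Injective)
open import Function.Bundles using (_⇔_)
open import Relation.Nullary using (¬_; does)
open import Relation.Binary.PropositionalEquality using (_≡_; _≢_)

sumℕ : ∀ {n} → (Fin n → ℕ) → ℕ
sumℕ {zero}  f = 0
sumℕ {suc n} f = f Data.Fin.zero ℕ.+ sumℕ (λ i → f (Data.Fin.suc i))

sumℤ : ∀ {n} → (Fin n → ℤ) → ℤ
sumℤ {zero}  f = + 0
sumℤ {suc n} f = f Data.Fin.zero ℤ.+ sumℤ (λ i → f (Data.Fin.suc i))

record Graph (N : ℕ) : Set where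
  field
    adj        : Fin N → Fin N → Bool
    adj-sym    : ∀ i j → adj i j ≡ adj j i
    adj-irrefl : ∀ i → adj i i ≡ false
open Graph public

b2n : Bool → ℕ
b2n true  = 1
b2n false = 0

deg : ∀ {N} → Graph N → Fin N → ℕ
deg H i = sumℕ (λ j → b2n (adj H i j))

edges : ∀ {N} → Graph N → ℕ
edges H = sumℕ (λ i → sumℕ (λ j → if toℕ i <ᵇ toℕ j then b2n (adj H i j) else 0))

laplacian : ∀ {N} → Graph N → Fin N → Fin N → ℤ
laplacian H i j =
  if does (i ≟ j) then + deg H i else - (+ b2n (adj H i j))

-- The graph obtained from a single vertex (vertex 0) by adding, in the
-- order 1, 2, ..., N-1, vertex j as a dominating vertex if d j ≡ true and
-- as an isolated vertex if d j ≡ false  (d 0 is irrelevant).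
thresholdAdj : ∀ {N} → (Fin N → Bool) → Fin N → Fin N → Bool
thresholdAdj d i j =
  if toℕ i <ᵇ toℕ j then d j else (if toℕ j <ᵇ toℕ i then d i else false)

IsThreshold : ∀ {N} → Graph N → Set
IsThreshold {N} H =
  (0 ℕ.< N) ×
  Σ (Fin N → Bool) λ d →
  Σ (Fin N → Fin N) λ σ →
    Injective _≡_ _≡_ σ × (∀ i j → adj H (σ i) (σ j) ≡ thresholdAdj d i j)

HasClique : ∀ {N} → Graph N → ℕ → Set
HasClique {N} H m =
  Σ (Fin m → Fin N) λ f →
    Injective _≡_ _≡_ f × (∀ a b → a ≢ b → adj H (f a) (f b) ≡ true)

CliqueNumber : ∀ {N} → Graph N → ℕ → Set
CliqueNumber H m = HasClique H m × ¬ HasClique H (suc m)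

-- Laplacian spectrum (integer-valued), given by a full orthogonal
-- eigenbasis: μ : Fin N → ℤ lists μ₁ ≥ ... ≥ μ_N, and v i is a nonzero
-- eigenvector for μ i, the v i pairwise orthogonal (hence a basis of ℚ^N,
-- so μ is exactly the spectrum with multiplicities).

dot : ∀ {N} → (Fin N → ℤ) → (Fin N → ℤ) → ℤ
dot x y = sumℤ (λ r → x r ℤ.* y r)

matVec : ∀ {N} → (Fin N → Fin N → ℤ) → (Fin N → ℤ) → Fin N → ℤ
matVec M x r = sumℤ (λ c → M r c ℤ.* x c)

IsLaplacianSpectrum : ∀ {N} → Graph N → (Fin N → ℤ) → Set
IsLaplacianSpectrum {N} H μ =
  (∀ i j → toℕ i ℕ.≤ toℕ j → μ j ℤ.≤ μ i) ×
  Σ (Fin N → Fin N → ℤ) λ v →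
    (∀ i → Σ (Fin N) λ r → v i r ≢ + 0) ×
    (∀ i j → i ≢ j → dot (v i) (v j) ≡ + 0) ×
    (∀ i r → matVec (laplacian H) (v i) r ≡ μ i ℤ.* v i r)

topSum : ∀ {N} → (Fin N → ℤ) → ℕ → ℤ
topSum μ k = sumℤ (λ i → if toℕ i <ᵇ k then μ i else + 0)

FullBrouwer : ∀ {N} → Graph N → (Fin N → ℤ) → Set
FullBrouwer {N} H μ =
  ∀ (k : Fin N) →
    (topSum μ (toℕ k) ℤ.≤ + (edges H ℕ.+ (suc (toℕ k) C 2))) ×
    ((topSum μ (toℕ k) ≡ + (edges H ℕ.+ (suc (toℕ k) C 2)))
       ⇔ (IsThreshold H × CliqueNumber H (suc (toℕ k))))

-- A threshold graph is built by repeatedly adding a vertex adjacent to all or to none of the m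
-- vertices already present, and its Laplacian spectrum can be followed along the construction.
-- If w is an eigenvector of the old graph orthogonal to the all-ones vector, then w extended by 0
-- at the new vertex is an eigenvector of the new one, with the eigenvalue raised by 1 when the new
-- vertex is dominating; together with (−m, 1, …, 1), of eigenvalue m + 1 or 0, and the all-ones
-- vector this gives an orthogonal integer eigenbasis. So a dominating vertex turns the eigenvalue
-- list λ into (m + 1, λ + 1) while raising e by m and the clique number by 1, and an isolated vertex
-- just appends a 0. Either way the bound s_k ≤ e + C(k+1, 2), with equality exactly when k + 1 is
-- the clique number, passes from the old graph to the new one. Finally every threshold graph is
-- isomorphic to one numbered along its construction, and isomorphisms preserve the spectrum, the
-- number of edges and the clique number.
module Submission where

open import Defs

import Algebra.Properties.CommutativeMonoid.Sum as CMSum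
open import Data.Bool using (Bool; true; false; if_then_else_; T)
open import Data.Empty using (⊥-elim)
open import Data.Fin as Fin using (Fin; zero; suc; toℕ)
open import Data.Fin.Permutation as Perm using (Permutation; _⟨$⟩ʳ_; _⟨$⟩ˡ_)
import Data.Fin.Properties as Finₚ
open import Data.Integer as ℤ using (ℤ; +_; -_)
import Data.Integer.Properties as ℤₚ
import Data.Integer.Tactic.RingSolver as ℤ-Solver
open import Data.List using (List; []; _∷_; _++_; _∷ʳ_; [_]; map; take; length)
import Data.List.Properties as Listₚ
open import Data.List.Relation.Unary.All as All using (All; []; _∷_)
import Data.List.Relation.Unary.All.Properties as Allₚ
open import Data.List.Relation.Unary.AllPairs as AllPairs using (AllPairs; []; _∷_)
import Data.List.Relation.Unary.AllPairs.Properties as AllPairsₚ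
open import Data.Nat as ℕ using (ℕ; zero; suc; _<ᵇ_)
open import Data.Nat.Combinatorics using (_C_; nC1≡n; nCk+nC[k+1]≡[n+1]C[k+1])
open import Data.Nat.ListAction using (sum)
import Data.Nat.ListAction.Properties as ListActionₚ
import Data.Nat.Properties as ℕₚ
import Data.Nat.Tactic.RingSolver as ℕ-Solver
open import Data.Product using (Σ; ∃; _×_; _,_; proj₁; proj₂)
open import Data.Sum using (inj₁; inj₂)
open import Data.Unit using (tt)
import Data.Vec.Functional as V
open import Function using (_∘_)
open import Function.Bundles using (_⇔_; mk⇔)
open import Function.Definitions using (Injective)
import Function.Properties.Equivalence as Equiv
open import Relation.Binary using (tri<; tri≈; tri>)
open import Relation.Binary.PropositionalEquality hiding ([_])
open import Relation.Nullary using (¬_; does; yes; no)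
open import Relation.Nullary.Reflects using (Reflects; fromEquivalence; det)

private
  variable
    m n : ℕ

module ∑ℕ = CMSum ℕₚ.+-0-commutativeMonoid
module ∑ℤ = CMSum ℤₚ.+-0-commutativeMonoid

sumℕ≡sum : (f : Fin n → ℕ) → sumℕ f ≡ ∑ℕ.sum f
sumℕ≡sum {zero}  f = refl
sumℕ≡sum {suc n} f = cong (f zero ℕ.+_) (sumℕ≡sum (f ∘ suc))

sumℤ≡sum : (f : Fin n → ℤ) → sumℤ f ≡ ∑ℤ.sum f
sumℤ≡sum {zero}  f = refl
sumℤ≡sum {suc n} f = cong (λ s → f zero ℤ.+ s) (sumℤ≡sum (f ∘ suc))

sumℕ-cong : {f g : Fin n → ℕ} → (∀ i → f i ≡ g i) → sumℕ f ≡ sumℕ g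
sumℕ-cong {zero}  _   = refl
sumℕ-cong {suc n} f≗g = cong₂ ℕ._+_ (f≗g zero) (sumℕ-cong (f≗g ∘ suc))

sumℤ-cong : {f g : Fin n → ℤ} → (∀ i → f i ≡ g i) → sumℤ f ≡ sumℤ g
sumℤ-cong {zero}  _   = refl
sumℤ-cong {suc n} f≗g = cong₂ ℤ._+_ (f≗g zero) (sumℤ-cong (f≗g ∘ suc))

sumℕ-permute : (f : Fin n → ℕ) (π : Permutation n n) → sumℕ f ≡ sumℕ (f ∘ (π ⟨$⟩ʳ_))
sumℕ-permute f π =
  trans (sumℕ≡sum f) (trans (∑ℕ.sum-permute f π) (sym (sumℕ≡sum (f ∘ (π ⟨$⟩ʳ_)))))

sumℤ-permute : (f : Fin n → ℤ) (π : Permutation n n) → sumℤ f ≡ sumℤ (f ∘ (π ⟨$⟩ʳ_))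
sumℤ-permute f π =
  trans (sumℤ≡sum f) (trans (∑ℤ.sum-permute f π) (sym (sumℤ≡sum (f ∘ (π ⟨$⟩ʳ_)))))

sumℕ-const : ∀ n c → sumℕ {n} (λ _ → c) ≡ n ℕ.* c
sumℕ-const zero    c = refl
sumℕ-const (suc n) c = cong (c ℕ.+_) (sumℕ-const n c)

+-sumℕ : (f : Fin n → ℕ) → + sumℕ f ≡ sumℤ (+_ ∘ f)
+-sumℕ {zero}  f = refl
+-sumℕ {suc n} f = trans (ℤₚ.pos-+ (f zero) _) (cong (λ s → + f zero ℤ.+ s) (+-sumℕ (f ∘ suc)))

sumℕ-distrib-+ : (f g : Fin n → ℕ) → sumℕ (λ i → f i ℕ.+ g i) ≡ sumℕ f ℕ.+ sumℕ g
sumℕ-distrib-+ f g =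
  trans (sumℕ≡sum (λ i → f i ℕ.+ g i))
        (trans (∑ℕ.∑-distrib-+ f g) (sym (cong₂ ℕ._+_ (sumℕ≡sum f) (sumℕ≡sum g))))

sumℤ-const : ∀ n c → sumℤ {n} (λ _ → + c) ≡ + (n ℕ.* c)
sumℤ-const n c = trans (sym (+-sumℕ {n} (λ _ → c))) (cong +_ (sumℕ-const n c))

sumℤ-ones : sumℤ {n} (λ _ → + 1) ≡ + n
sumℤ-ones {n} = trans (sumℤ-const n 1) (cong +_ (ℕₚ.*-identityʳ n))

module _ where
  open import Data.Integer using (_+_; _*_; _-_)

  sumℤ-zero : sumℤ {n} (λ _ → + 0) ≡ + 0
  sumℤ-zero {n} = trans (sumℤ-const n 0) (cong +_ (ℕₚ.*-zeroʳ n))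

  sumℤ-distrib-minus : (f g : Fin n → ℤ) → sumℤ (λ i → f i - g i) ≡ sumℤ f - sumℤ g
  sumℤ-distrib-minus {zero}  f g = refl
  sumℤ-distrib-minus {suc n} f g =
    trans (cong (λ s → (f zero - g zero) + s) (sumℤ-distrib-minus (f ∘ suc) (g ∘ suc)))
          (interchange (f zero) (g zero) _ _)
    where
      interchange : ∀ a b c d → (a - b) + (c - d) ≡ (a + c) - (b + d)
      interchange = ℤ-Solver.solve-∀

  *-distribˡ-sumℤ : ∀ c (f : Fin n → ℤ) → sumℤ (λ i → c * f i) ≡ c * sumℤ f
  *-distribˡ-sumℤ {zero}  c f = sym (ℤₚ.*-zeroʳ c)
  *-distribˡ-sumℤ {suc n} c f =
    trans (cong (λ s → c * f zero + s) (*-distribˡ-sumℤ c (f ∘ suc))) (sym (ℤₚ.*-distribˡ-+ c (f zero) _))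

  sumℤ-δ : (r : Fin n) (f : Fin n → ℤ) → sumℤ (λ c → if does (r Fin.≟ c) then f c else + 0) ≡ f r
  sumℤ-δ {suc n} zero    f = trans (cong (λ s → f zero + s) (sumℤ-zero {n})) (ℤₚ.+-identityʳ (f zero))
  sumℤ-δ {suc n} (suc r) f = trans (ℤₚ.+-identityˡ _) (sumℤ-δ r (f ∘ suc))

injective⇒surjective : (σ : Fin n → Fin n) → Injective _≡_ _≡_ σ → ∀ y → ∃ λ x → σ x ≡ y
injective⇒surjective {suc n} σ σ-inj y with Finₚ.any? (λ x → σ x Fin.≟ y)
... | yes hit = hit
... | no miss = ⊥-elim (ℕₚ.<-irrefl refl (Finₚ.injective⇒≤ punchOut-σ-injective))
  where
    y≢σ : ∀ x → y ≢ σ x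
    y≢σ x y≡σx = miss (x , sym y≡σx)
    punchOut-σ-injective : Injective _≡_ _≡_ (λ x → Fin.punchOut (y≢σ x))
    punchOut-σ-injective {a} {b} eq = σ-inj (Finₚ.punchOut-injective (y≢σ a) (y≢σ b) eq)

injective⇒permutation : (σ : Fin n → Fin n) → Injective _≡_ _≡_ σ → Permutation n n
injective⇒permutation σ σ-inj =
  Perm.permutation σ (proj₁ ∘ surjective) (proj₂ ∘ surjective) (λ x → σ-inj (proj₂ (surjective (σ x))))
  where
    surjective : ∀ y → ∃ λ x → σ x ≡ y
    surjective = injective⇒surjective σ σ-inj

m+m≡n+n⇒m≡n : ∀ {m n} → m ℕ.+ m ≡ n ℕ.+ n → m ≡ n
m+m≡n+n⇒m≡n {m} {n} eq with ℕₚ.<-cmp m n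
... | tri< m<n _ _ = ⊥-elim (ℕₚ.<-irrefl eq (ℕₚ.+-mono-< m<n m<n))
... | tri≈ _ m≡n _ = m≡n
... | tri> _ _ n<m = ⊥-elim (ℕₚ.<-irrefl (sym eq) (ℕₚ.+-mono-< n<m n<m))

-- Laplacian action, cliques and isomorphisms

module _ where
  open import Data.Nat using (_+_)

  private
    upperSum : (Fin n → Fin n → Bool) → ℕ
    upperSum a = sumℕ (λ i → sumℕ (λ j → if toℕ i <ᵇ toℕ j then b2n (a i j) else 0))

    handshake-matrix : (a : Fin n → Fin n → Bool) → (∀ i j → a i j ≡ a j i) → (∀ i → a i i ≡ false) →
                 sumℕ (λ i → sumℕ (λ j → b2n (a i j))) ≡ upperSum a + upperSum a
    handshake-matrix {zero}  a sym-a irr-a = refl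
    handshake-matrix {suc n} a sym-a irr-a = begin
      (b2n (a zero zero) + R) + sumℕ (λ i → b2n (a (suc i) zero) + sumℕ (λ j → b2n (a (suc i) (suc j))))
        ≡⟨ cong₂ _+_ (cong (λ b → b2n b + R) (irr-a zero))
                 (sumℕ-distrib-+ (λ i → b2n (a (suc i) zero))
                                 (λ i → sumℕ (λ j → b2n (a (suc i) (suc j))))) ⟩
      R + (sumℕ (λ i → b2n (a (suc i) zero)) + sumℕ (λ i → sumℕ (λ j → b2n (a (suc i) (suc j)))))
        ≡⟨ cong₂ (λ c d → R + (c + d)) (sumℕ-cong (λ i → cong b2n (sym-a (suc i) zero)))
                 (handshake-matrix (λ i j → a (suc i) (suc j)) (λ i j → sym-a (suc i) (suc j)) (irr-a ∘ suc)) ⟩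
      R + (R + (U + U))
        ≡⟨ regroup R U ⟩
      (R + U) + (R + U) ∎
      where
        open ≡-Reasoning
        R U : ℕ
        R = sumℕ (λ j → b2n (a zero (suc j)))
        U = upperSum (λ i j → a (suc i) (suc j))
        regroup : ∀ r t → r + (r + (t + t)) ≡ (r + t) + (r + t)
        regroup = ℕ-Solver.solve-∀

  handshake : (X : Graph n) → sumℕ (deg X) ≡ edges X + edges X
  handshake X = handshake-matrix (adj X) (adj-sym X) (adj-irrefl X)

module _ where
  open import Data.Integer using (_+_; _*_; _-_)

  adjacencyAction : Graph n → (Fin n → ℤ) → Fin n → ℤ
  adjacencyAction X x r = sumℤ (λ c → + b2n (adj X r c) * x c)

  laplacianAction : Graph n → (Fin n → ℤ) → Fin n → ℤ
  laplacianAction X x r = + deg X r * x r - adjacencyAction X x r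

  matVec-laplacian : (X : Graph n) (x : Fin n → ℤ) (r : Fin n) →
                     matVec (laplacian X) x r ≡ laplacianAction X x r
  matVec-laplacian X x r = begin
    sumℤ (λ c → laplacian X r c * x c)
      ≡⟨ sumℤ-cong entry ⟩
    sumℤ (λ c → diagonal c - + b2n (adj X r c) * x c)
      ≡⟨ sumℤ-distrib-minus diagonal (λ c → + b2n (adj X r c) * x c) ⟩
    sumℤ diagonal - adjacencyAction X x r
      ≡⟨ cong (_- adjacencyAction X x r) (sumℤ-δ r (λ c → + deg X r * x c)) ⟩
    laplacianAction X x r ∎
    where
      open ≡-Reasoning
      diagonal : Fin _ → ℤ
      diagonal c = if does (r Fin.≟ c) then + deg X r * x c else + 0
      entry : ∀ c → laplacian X r c * x c ≡ diagonal c - + b2n (adj X r c) * x c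
      entry c with r Fin.≟ c
      ... | yes refl rewrite adj-irrefl X r = sym (ℤₚ.+-identityʳ (+ deg X r * x r))
      ... | no _ = trans (sym (ℤₚ.neg-distribˡ-* (+ b2n (adj X r c)) (x c)))
                         (sym (ℤₚ.+-identityˡ (- (+ b2n (adj X r c) * x c))))

  laplacianAction-cong : (X : Graph n) {x y : Fin n → ℤ} → (∀ c → x c ≡ y c) →
                         ∀ r → laplacianAction X x r ≡ laplacianAction X y r
  laplacianAction-cong X x≗y r =
    cong₂ (λ a b → + deg X r * a - b) (x≗y r) (sumℤ-cong (λ c → cong (+ b2n (adj X r c) *_) (x≗y c)))

  laplacianAction-ones : (X : Graph n) → ∀ r → laplacianAction X (λ _ → + 1) r ≡ + 0
  laplacianAction-ones X r = begin
    + deg X r * + 1 - sumℤ (λ c → + b2n (adj X r c) * + 1)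
      ≡⟨ cong₂ _-_ (ℤₚ.*-identityʳ (+ deg X r))
                   (sumℤ-cong (λ c → ℤₚ.*-identityʳ (+ b2n (adj X r c)))) ⟩
    + deg X r - sumℤ (λ c → + b2n (adj X r c))
      ≡⟨ cong (λ s → + deg X r - s) (sym (+-sumℕ (b2n ∘ adj X r))) ⟩
    + deg X r - + deg X r
      ≡⟨ ℤₚ.+-inverseʳ (+ deg X r) ⟩
    + 0 ∎
    where open ≡-Reasoning

record IsIsomorphism (G H : Graph n) (π : Permutation n n) : Set where
  field
    adj-iso : ∀ x y → adj H (π ⟨$⟩ʳ x) (π ⟨$⟩ʳ y) ≡ adj G x y

HasClique-embed : ∀ {k} (X : Graph m) (Y : Graph n) (g : Fin m → Fin n) → Injective _≡_ _≡_ g →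
                  (∀ x y → adj X x y ≡ true → adj Y (g x) (g y) ≡ true) →
                  HasClique X k → HasClique Y k
HasClique-embed X Y g g-inj g-hom (f , f-inj , f-clique) =
  g ∘ f , f-inj ∘ g-inj , λ a b a≢b → g-hom (f a) (f b) (f-clique a b a≢b)

HasClique-≤ : ∀ {k l} (X : Graph n) → k ℕ.≤ l → HasClique X l → HasClique X k
HasClique-≤ X k≤l (f , f-inj , f-clique) =
  f ∘ (λ a → Fin.inject≤ a k≤l) ,
  (λ {a} {b} eq → Finₚ.inject≤-injective k≤l k≤l a b (f-inj eq)) ,
  λ a b a≢b → f-clique _ _ (a≢b ∘ Finₚ.inject≤-injective k≤l k≤l a b)

HasClique⇒≤ : ∀ {k} (X : Graph n) → HasClique X k → k ℕ.≤ n
HasClique⇒≤ X (f , f-inj , _) = Finₚ.injective⇒≤ f-inj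

CliqueNumber-unique : ∀ {k l} (X : Graph n) → CliqueNumber X k → CliqueNumber X l → k ≡ l
CliqueNumber-unique {k = k} {l} X (has-k , no-k) (has-l , no-l) with ℕₚ.<-cmp k l
... | tri< k<l _ _ = ⊥-elim (no-k (HasClique-≤ X k<l has-l))
... | tri≈ _ k≡l _ = k≡l
... | tri> _ _ l<k = ⊥-elim (no-l (HasClique-≤ X l<k has-k))

module _ {G H : Graph n} {π : Permutation n n} (iso : IsIsomorphism G H π) where
  open import Data.Integer using (_*_)
  open IsIsomorphism iso

  flip-iso : IsIsomorphism H G (Perm.flip π)
  flip-iso = record { adj-iso = λ x y →
    trans (sym (adj-iso (π ⟨$⟩ˡ x) (π ⟨$⟩ˡ y))) (cong₂ (adj H) (Perm.inverseʳ π) (Perm.inverseʳ π)) }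

  HasClique-iso : ∀ {k} → HasClique G k → HasClique H k
  HasClique-iso = HasClique-embed G H (π ⟨$⟩ʳ_) π-injective (λ x y xy → trans (adj-iso x y) xy)
    where
      π-injective : Injective _≡_ _≡_ (π ⟨$⟩ʳ_)
      π-injective eq = trans (sym (Perm.inverseˡ π)) (trans (cong (π ⟨$⟩ˡ_) eq) (Perm.inverseˡ π))

  deg-iso : ∀ r → deg H (π ⟨$⟩ʳ r) ≡ deg G r
  deg-iso r = trans (sumℕ-permute (b2n ∘ adj H (π ⟨$⟩ʳ r)) π) (sumℕ-cong (cong b2n ∘ adj-iso r))

  edges-iso : edges H ≡ edges G
  edges-iso = m+m≡n+n⇒m≡n (begin
    edges H ℕ.+ edges H   ≡⟨ sym (handshake H) ⟩
    sumℕ (deg H)          ≡⟨ sumℕ-permute (deg H) π ⟩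
    sumℕ (deg H ∘ (π ⟨$⟩ʳ_)) ≡⟨ sumℕ-cong deg-iso ⟩
    sumℕ (deg G)          ≡⟨ handshake G ⟩
    edges G ℕ.+ edges G   ∎)
    where open ≡-Reasoning

  laplacianAction-iso : ∀ x r → laplacianAction H x (π ⟨$⟩ʳ r) ≡ laplacianAction G (x ∘ (π ⟨$⟩ʳ_)) r
  laplacianAction-iso x r =
    cong₂ (λ d a → + d * x (π ⟨$⟩ʳ r) ℤ.- a) (deg-iso r)
      (trans (sumℤ-permute (λ c → + b2n (adj H (π ⟨$⟩ʳ r) c) * x c) π)
             (sumℤ-cong (λ c → cong (λ b → + b2n b * x (π ⟨$⟩ʳ c)) (adj-iso r c))))

  IsLaplacianSpectrum-iso : ∀ {μ} → IsLaplacianSpectrum G μ → IsLaplacianSpectrum H μ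
  IsLaplacianSpectrum-iso {μ} (sorted , v , nonzero , orthogonal , eigen) =
    sorted , v′ , nonzero′ , orthogonal′ , eigen′
    where
      v′ : Fin n → Fin n → ℤ
      v′ i = v i ∘ (π ⟨$⟩ˡ_)
      v′∘π : ∀ i r → v′ i (π ⟨$⟩ʳ r) ≡ v i r
      v′∘π i r = cong (v i) (Perm.inverseˡ π)
      nonzero′ : ∀ i → Σ (Fin n) λ r → v′ i r ≢ + 0
      nonzero′ i with r , vᵢr≢0 ← nonzero i = π ⟨$⟩ʳ r , vᵢr≢0 ∘ trans (sym (v′∘π i r))
      orthogonal′ : ∀ i j → i ≢ j → dot (v′ i) (v′ j) ≡ + 0
      orthogonal′ i j i≢j =
        trans (sumℤ-permute (λ r → v′ i r * v′ j r) π)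
              (trans (sumℤ-cong (λ r → cong₂ _*_ (v′∘π i r) (v′∘π j r))) (orthogonal i j i≢j))
      eigen′ : ∀ i r → matVec (laplacian H) (v′ i) r ≡ μ i * v′ i r
      eigen′ i r = begin
        matVec (laplacian H) (v′ i) r                   ≡⟨ matVec-laplacian H (v′ i) r ⟩
        laplacianAction H (v′ i) r                      ≡⟨ cong (laplacianAction H (v′ i)) (sym (Perm.inverseʳ π)) ⟩
        laplacianAction H (v′ i) (π ⟨$⟩ʳ (π ⟨$⟩ˡ r))     ≡⟨ laplacianAction-iso (v′ i) (π ⟨$⟩ˡ r) ⟩
        laplacianAction G (v′ i ∘ (π ⟨$⟩ʳ_)) (π ⟨$⟩ˡ r)  ≡⟨ laplacianAction-cong G (v′∘π i) (π ⟨$⟩ˡ r) ⟩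
        laplacianAction G (v i) (π ⟨$⟩ˡ r)              ≡⟨ sym (matVec-laplacian G (v i) (π ⟨$⟩ˡ r)) ⟩
        matVec (laplacian G) (v i) (π ⟨$⟩ˡ r)           ≡⟨ eigen i (π ⟨$⟩ˡ r) ⟩
        μ i * v′ i r                                    ∎
        where open ≡-Reasoning

-- Threshold graphs numbered from the newest vertex

-- Vertex 0 is the vertex added last, and vertex i is adjacent to the older vertices j > i exactly
-- when e i is true; the value of e at the oldest vertex is irrelevant.
revThresholdAdj : (Fin n → Bool) → Fin n → Fin n → Bool
revThresholdAdj e zero    zero    = false
revThresholdAdj e zero    (suc j) = e zero
revThresholdAdj e (suc i) zero    = e zero
revThresholdAdj e (suc i) (suc j) = revThresholdAdj (e ∘ suc) i j

revThresholdAdj-sym : (e : Fin n → Bool) → ∀ i j → revThresholdAdj e i j ≡ revThresholdAdj e j i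
revThresholdAdj-sym e zero    zero    = refl
revThresholdAdj-sym e zero    (suc j) = refl
revThresholdAdj-sym e (suc i) zero    = refl
revThresholdAdj-sym e (suc i) (suc j) = revThresholdAdj-sym (e ∘ suc) i j

revThresholdAdj-irrefl : (e : Fin n → Bool) → ∀ i → revThresholdAdj e i i ≡ false
revThresholdAdj-irrefl e zero    = refl
revThresholdAdj-irrefl e (suc i) = revThresholdAdj-irrefl (e ∘ suc) i

RevThreshold : (Fin n → Bool) → Graph n
RevThreshold e = record
  { adj = revThresholdAdj e ; adj-sym = revThresholdAdj-sym e ; adj-irrefl = revThresholdAdj-irrefl e }

revThresholdAdj-closed : (e : Fin n → Bool) → ∀ x y →
  revThresholdAdj e x y ≡ (if toℕ x <ᵇ toℕ y then e x else (if toℕ y <ᵇ toℕ x then e y else false))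
revThresholdAdj-closed e zero    zero    = refl
revThresholdAdj-closed e zero    (suc j) = refl
revThresholdAdj-closed e (suc i) zero    = refl
revThresholdAdj-closed e (suc i) (suc j) = revThresholdAdj-closed (e ∘ suc) i j

opposite-<-reflects : (x y : Fin n) →
  Reflects (toℕ (Fin.opposite x) ℕ.< toℕ (Fin.opposite y)) (toℕ y <ᵇ toℕ x)
opposite-<-reflects {n} x y =
  fromEquivalence (reverse ∘ ℕₚ.<ᵇ⇒< (toℕ y) (toℕ x)) (ℕₚ.<⇒<ᵇ ∘ reflect)
  where
    opp : ∀ z → toℕ (Fin.opposite z) ≡ n ℕ.∸ suc (toℕ z)
    opp = Finₚ.opposite-prop
    reverse : toℕ y ℕ.< toℕ x → toℕ (Fin.opposite x) ℕ.< toℕ (Fin.opposite y)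
    reverse y<x rewrite opp x | opp y = ℕₚ.∸-monoʳ-< (ℕ.s≤s y<x) (Finₚ.toℕ<n x)
    reflect : toℕ (Fin.opposite x) ℕ.< toℕ (Fin.opposite y) → toℕ y ℕ.< toℕ x
    reflect lt rewrite opp x | opp y =
      ℕₚ.≰⇒> λ x≤y → ℕₚ.<-irrefl refl (ℕₚ.<-≤-trans lt (ℕₚ.∸-monoʳ-≤ n (ℕ.s≤s x≤y)))

<ᵇ-opposite : (x y : Fin n) → (toℕ (Fin.opposite x) <ᵇ toℕ (Fin.opposite y)) ≡ (toℕ y <ᵇ toℕ x)
<ᵇ-opposite x y = det (ℕₚ.<ᵇ-reflects-< _ _) (opposite-<-reflects x y)

thresholdAdj-opposite : (d : Fin n → Bool) → ∀ x y →
  thresholdAdj d (Fin.opposite x) (Fin.opposite y) ≡ revThresholdAdj (d ∘ Fin.opposite) x y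
thresholdAdj-opposite d x y
  rewrite <ᵇ-opposite x y | <ᵇ-opposite y x | revThresholdAdj-closed (d ∘ Fin.opposite) x y
  with toℕ y <ᵇ toℕ x in y<x | toℕ x <ᵇ toℕ y in x<y
... | false | _     = refl
... | true  | false = refl
... | true  | true  =
  ⊥-elim (ℕₚ.<-asym (ℕₚ.<ᵇ⇒< (toℕ y) (toℕ x) (subst T (sym y<x) tt))
                    (ℕₚ.<ᵇ⇒< (toℕ x) (toℕ y) (subst T (sym x<y) tt)))

IsThreshold⇒isomorphic : (H : Graph n) → IsThreshold H →
  Σ (Fin n → Bool) λ e → Σ (Permutation n n) λ π → IsIsomorphism (RevThreshold e) H π
IsThreshold⇒isomorphic H (_ , d , σ , σ-inj , σ-iso) =
  d ∘ Fin.opposite , injective⇒permutation (σ ∘ Fin.opposite) σ′-inj ,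
  record { adj-iso = λ x y → trans (σ-iso _ _) (thresholdAdj-opposite d x y) }
  where
    σ′-inj : Injective _≡_ _≡_ (σ ∘ Fin.opposite)
    σ′-inj {x} {y} eq = trans (sym (Finₚ.opposite-involutive x))
                              (trans (cong Fin.opposite (σ-inj eq)) (Finₚ.opposite-involutive y))

module _ (e : Fin (suc n) → Bool) where

  HasClique-tail : ∀ {k} → HasClique (RevThreshold (e ∘ suc)) k → HasClique (RevThreshold e) k
  HasClique-tail =
    HasClique-embed (RevThreshold (e ∘ suc)) (RevThreshold e) suc Finₚ.suc-injective (λ _ _ adj≡true → adj≡true)

  HasClique-dominating : ∀ {k} → e zero ≡ true →
    HasClique (RevThreshold (e ∘ suc)) k → HasClique (RevThreshold e) (suc k)
  HasClique-dominating {k} e₀ (f , f-inj , f-clique) = f′ , f′-inj , f′-clique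
    where
      f′ : Fin (suc k) → Fin (suc n)
      f′ zero    = zero
      f′ (suc a) = suc (f a)
      f′-inj : Injective _≡_ _≡_ f′
      f′-inj {zero}  {zero}  _  = refl
      f′-inj {suc a} {suc b} eq = cong suc (f-inj (Finₚ.suc-injective eq))
      f′-clique : ∀ a b → a ≢ b → revThresholdAdj e (f′ a) (f′ b) ≡ true
      f′-clique zero    zero    a≢b = ⊥-elim (a≢b refl)
      f′-clique zero    (suc b) _   = e₀
      f′-clique (suc a) zero    _   = e₀
      f′-clique (suc a) (suc b) a≢b = f-clique a b (a≢b ∘ cong suc)

  private
    clique-avoiding-zero : ∀ {k} (f : Fin k → Fin (suc n)) → Injective _≡_ _≡_ f →
      (∀ a b → a ≢ b → revThresholdAdj e (f a) (f b) ≡ true) → (∀ a → f a ≢ zero) →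
      HasClique (RevThreshold (e ∘ suc)) k
    clique-avoiding-zero f f-inj f-clique f≢0 = f′ , f′-inj , f′-clique
      where
        f′ : Fin _ → Fin n
        f′ a = Fin.punchOut {i = zero} (f≢0 a ∘ sym)
        suc-f′ : ∀ a → suc (f′ a) ≡ f a
        suc-f′ a = Finₚ.punchIn-punchOut {i = zero} (f≢0 a ∘ sym)
        f′-inj : Injective _≡_ _≡_ f′
        f′-inj {a} {b} eq = f-inj (trans (sym (suc-f′ a)) (trans (cong suc eq) (suc-f′ b)))
        f′-clique : ∀ a b → a ≢ b → revThresholdAdj (e ∘ suc) (f′ a) (f′ b) ≡ true
        f′-clique a b a≢b =
          subst₂ (λ x y → revThresholdAdj e x y ≡ true) (sym (suc-f′ a)) (sym (suc-f′ b)) (f-clique a b a≢b)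

  HasClique-removeZero : ∀ {k} → HasClique (RevThreshold e) (suc k) → HasClique (RevThreshold (e ∘ suc)) k
  HasClique-removeZero (f , f-inj , f-clique) with Finₚ.any? (λ a → f a Fin.≟ zero)
  ... | yes (a₀ , fa₀≡0) = clique-avoiding-zero (f ∘ Fin.punchIn a₀) (Finₚ.punchIn-injective a₀ _ _ ∘ f-inj)
                         (λ x y x≢y → f-clique _ _ (x≢y ∘ Finₚ.punchIn-injective a₀ x y))
                         (λ x fx≡0 → Finₚ.punchInᵢ≢i a₀ x (f-inj (trans fx≡0 (sym fa₀≡0))))
  ... | no  ¬hit    = clique-avoiding-zero (f ∘ Fin.punchIn zero) (Finₚ.punchIn-injective zero _ _ ∘ f-inj)
                         (λ x y x≢y → f-clique _ _ (x≢y ∘ Finₚ.punchIn-injective zero x y))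
                         (λ x fx≡0 → ¬hit (_ , fx≡0))

  HasClique-isolated : ∀ {k} → e zero ≡ false →
    HasClique (RevThreshold e) (suc (suc k)) → HasClique (RevThreshold (e ∘ suc)) (suc (suc k))
  HasClique-isolated e₀ (f , f-inj , f-clique) = clique-avoiding-zero f f-inj f-clique f≢0
    where
      zero-isolated : ∀ j → revThresholdAdj e zero j ≢ true
      zero-isolated zero    ()
      zero-isolated (suc j) adj≡true with () ← trans (sym e₀) adj≡true
      f≢0 : ∀ a → f a ≢ zero
      f≢0 a fa≡0 =
        zero-isolated (f b) (subst (λ x → revThresholdAdj e x (f b) ≡ true) fa≡0 (f-clique a b (b≢a ∘ sym)))
        where
          b : Fin _
          b = Fin.punchIn a zero
          b≢a : b ≢ a
          b≢a = Finₚ.punchInᵢ≢i a zero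

-- Laplacian eigenvectors of threshold graphs

module _ (e : Fin (suc n) → Bool) (x : Fin (suc n) → ℤ) where
  open import Data.Integer using (_+_; _*_; _-_)
  private
    B : ℕ
    B = b2n (e zero)

  laplacianAction-revThreshold-zero :
    laplacianAction (RevThreshold e) x zero ≡ + (n ℕ.* B) * x zero - + B * sumℤ (x ∘ suc)
  laplacianAction-revThreshold-zero =
    cong₂ (λ d a → + d * x zero - a) (sumℕ-const n B)
          (trans (cong (_+ sumℤ (λ c → + B * x (suc c))) (ℤₚ.*-zeroˡ (x zero)))
                 (trans (ℤₚ.+-identityˡ _) (*-distribˡ-sumℤ (+ B) (x ∘ suc))))

  laplacianAction-revThreshold-suc : ∀ i →
    laplacianAction (RevThreshold e) x (suc i) ≡
    + B * (x (suc i) - x zero) + laplacianAction (RevThreshold (e ∘ suc)) (x ∘ suc) i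
  laplacianAction-revThreshold-suc i =
    trans (cong (λ d → d * x (suc i) - (+ B * x zero + adjacencyAction G′ (x ∘ suc) i))
                (ℤₚ.pos-+ B (deg G′ i)))
          (regroup (+ B) (+ deg G′ i) (x (suc i)) (x zero) (adjacencyAction G′ (x ∘ suc) i))
    where
      G′ : Graph n
      G′ = RevThreshold (e ∘ suc)
      regroup : ∀ b d y y₀ a → (b + d) * y - (b * y₀ + a) ≡ b * (y - y₀) + (d * y - a)
      regroup = ℤ-Solver.solve-∀

Eigenpair : ℕ → Set
Eigenpair n = ℕ × (Fin n → ℤ)

IsEigenpair : Graph n → Eigenpair n → Set
IsEigenpair {n} X (a , v) = (∀ r → laplacianAction X v r ≡ + a ℤ.* v r) × (Σ (Fin n) λ r → v r ≢ + 0)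

IsBalancedEigenpair : Graph n → Eigenpair n → Set
IsBalancedEigenpair X p = IsEigenpair X p × sumℤ (proj₂ p) ≡ + 0

Orthogonal : Eigenpair n → Eigenpair n → Set
Orthogonal (_ , v) (_ , w) = dot v w ≡ + 0

extendEigenpair : Bool → Eigenpair n → Eigenpair (suc n)
extendEigenpair b (a , w) = b2n b ℕ.+ a , + 0 V.∷ w

pivotVector : ∀ n → Fin (suc n) → ℤ
pivotVector n = - + n V.∷ λ _ → + 1

ones-eigenpair : (X : Graph (suc n)) → IsEigenpair X (0 , λ _ → + 1)
ones-eigenpair X = laplacianAction-ones X , zero , λ ()

module _ where
  open import Data.Integer using (_+_; _*_; _-_)

  dot-comm : (v w : Fin n → ℤ) → dot v w ≡ dot w v
  dot-comm v w = sumℤ-cong (λ r → ℤₚ.*-comm (v r) (w r))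

  dot-ones : (v : Fin n → ℤ) → dot v (λ _ → + 1) ≡ sumℤ v
  dot-ones v = sumℤ-cong (ℤₚ.*-identityʳ ∘ v)

  dot-extend : (v w : Fin n → ℤ) → dot (+ 0 V.∷ v) (+ 0 V.∷ w) ≡ dot v w
  dot-extend v w = ℤₚ.+-identityˡ (dot v w)

  dot-extend-pivot : (w : Fin n → ℤ) → dot (+ 0 V.∷ w) (pivotVector n) ≡ sumℤ w
  dot-extend-pivot w = trans (ℤₚ.+-identityˡ _) (dot-ones w)

  module _ (e : Fin (suc n) → Bool) {b : Bool} (e₀ : e zero ≡ b) where

    extendEigenpair-balanced : ∀ {p} → IsBalancedEigenpair (RevThreshold (e ∘ suc)) p →
                               IsBalancedEigenpair (RevThreshold e) (extendEigenpair b p)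
    extendEigenpair-balanced {a , w} ((eigen , r , wᵣ≢0) , sum≡0) =
      (eigen′ , suc r , wᵣ≢0) , trans (ℤₚ.+-identityˡ _) sum≡0
      where
        B : ℕ
        B = b2n b
        eigen′ : ∀ r → laplacianAction (RevThreshold e) (+ 0 V.∷ w) r ≡ + (B ℕ.+ a) * (+ 0 V.∷ w) r
        eigen′ zero = begin
          laplacianAction (RevThreshold e) (+ 0 V.∷ w) zero
            ≡⟨ laplacianAction-revThreshold-zero e (+ 0 V.∷ w) ⟩
          + (n ℕ.* b2n (e zero)) * + 0 - + b2n (e zero) * sumℤ w
            ≡⟨ cong (λ s → + (n ℕ.* b2n (e zero)) * + 0 - + b2n (e zero) * s) sum≡0 ⟩
          + (n ℕ.* b2n (e zero)) * + 0 - + b2n (e zero) * + 0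
            ≡⟨ annihilate (+ (n ℕ.* b2n (e zero))) (+ b2n (e zero)) (+ (B ℕ.+ a)) ⟩
          + (B ℕ.+ a) * + 0 ∎
          where
            open ≡-Reasoning
            annihilate : ∀ d c k → d * + 0 - c * + 0 ≡ k * + 0
            annihilate = ℤ-Solver.solve-∀
        eigen′ (suc i) = begin
          laplacianAction (RevThreshold e) (+ 0 V.∷ w) (suc i)
            ≡⟨ laplacianAction-revThreshold-suc e (+ 0 V.∷ w) i ⟩
          + b2n (e zero) * (w i - + 0) + laplacianAction (RevThreshold (e ∘ suc)) w i
            ≡⟨ cong₂ (λ c l → + b2n c * (w i - + 0) + l) e₀ (eigen i) ⟩
          + B * (w i - + 0) + + a * w i
            ≡⟨ collect (+ B) (+ a) (w i) ⟩
          (+ B + + a) * w i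
            ≡⟨ cong (_* w i) (sym (ℤₚ.pos-+ B a)) ⟩
          + (B ℕ.+ a) * w i ∎
          where
            open ≡-Reasoning
            collect : ∀ c k y → c * (y - + 0) + k * y ≡ (c + k) * y
            collect = ℤ-Solver.solve-∀

  module _ (e : Fin (suc (suc n)) → Bool) {b : Bool} (e₀ : e zero ≡ b) where

    pivot-balanced : IsBalancedEigenpair (RevThreshold e) (b2n b ℕ.* suc (suc n) , pivotVector (suc n))
    pivot-balanced = (eigen , zero , λ ()) , sum≡0
      where
        k B : ℕ
        k = suc n
        B = b2n b
        sum≡0 : sumℤ (pivotVector k) ≡ + 0
        sum≡0 = trans (cong (λ s → - + k + s) (sumℤ-ones {k})) (ℤₚ.+-inverseˡ (+ k))
        eigen : ∀ r → laplacianAction (RevThreshold e) (pivotVector k) r ≡ + (B ℕ.* suc k) * pivotVector k r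
        eigen zero = begin
          laplacianAction (RevThreshold e) (pivotVector k) zero
            ≡⟨ laplacianAction-revThreshold-zero e (pivotVector k) ⟩
          + (k ℕ.* b2n (e zero)) * - + k - + b2n (e zero) * sumℤ {k} (λ _ → + 1)
            ≡⟨ cong₂ (λ c s → + (k ℕ.* b2n c) * - + k - + b2n c * s) e₀ sumℤ-ones ⟩
          + (k ℕ.* B) * - + k - + B * + k
            ≡⟨ cong (λ d → d * - + k - + B * + k) (ℤₚ.pos-* k B) ⟩
          (+ k * + B) * - + k - + B * + k
            ≡⟨ factor (+ k) (+ B) ⟩
          (+ B * (+ 1 + + k)) * - + k
            ≡⟨ cong (_* - + k) (sym (ℤₚ.pos-* B (suc k))) ⟩
          + (B ℕ.* suc k) * - + k ∎
          where
            open ≡-Reasoning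
            factor : ∀ a c → (a * c) * - a - c * a ≡ (c * (+ 1 + a)) * - a
            factor = ℤ-Solver.solve-∀
        eigen (suc i) = begin
          laplacianAction (RevThreshold e) (pivotVector k) (suc i)
            ≡⟨ laplacianAction-revThreshold-suc e (pivotVector k) i ⟩
          + b2n (e zero) * (+ 1 - - + k) + laplacianAction (RevThreshold (e ∘ suc)) (λ _ → + 1) i
            ≡⟨ cong₂ (λ c l → + b2n c * (+ 1 - - + k) + l) e₀
                     (laplacianAction-ones (RevThreshold (e ∘ suc)) i) ⟩
          + B * (+ 1 - - + k) + + 0
            ≡⟨ factor (+ B) (+ k) ⟩
          (+ B * (+ 1 + + k)) * + 1
            ≡⟨ cong (_* + 1) (sym (ℤₚ.pos-* B (suc k))) ⟩
          + (B ℕ.* suc k) * + 1 ∎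
          where
            open ≡-Reasoning
            factor : ∀ c a → c * (+ 1 - - a) + + 0 ≡ (c * (+ 1 + a)) * + 1
            factor = ℤ-Solver.solve-∀

-- Brouwer bounds for eigenvalue lists

Sharp : {A : Set} → (A → A → Set) → A → A → Set → Set
Sharp _≤_ t r P = (t ≤ r) × (t ≡ r ⇔ P)

Sharp-resp : ∀ {A : Set} (_≤_ : A → A → Set) {t t′ r r′ P Q} →
             t ≡ t′ → r ≡ r′ → P ⇔ Q → Sharp _≤_ t r P → Sharp _≤_ t′ r′ Q
Sharp-resp _ refl refl P⇔Q (t≤r , t≡r⇔P) = t≤r , Equiv.trans t≡r⇔P P⇔Q

Sharp-+ˡ : ∀ x {t r P} → Sharp ℕ._≤_ t r P → Sharp ℕ._≤_ (x ℕ.+ t) (x ℕ.+ r) P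
Sharp-+ˡ x (t≤r , t≡r⇔P) =
  ℕₚ.+-monoʳ-≤ x t≤r , Equiv.trans (mk⇔ (ℕₚ.+-cancelˡ-≡ x _ _) (cong (x ℕ.+_))) t≡r⇔P

Sharp-< : ∀ {t r P} → t ℕ.< r → ¬ P → Sharp ℕ._≤_ t r P
Sharp-< t<r ¬P = ℕₚ.<⇒≤ t<r , mk⇔ (λ t≡r → ⊥-elim (ℕₚ.<⇒≢ t<r t≡r)) (⊥-elim ∘ ¬P)

Sharp-+ : ∀ {t r P} → Sharp ℕ._≤_ t r P → Sharp ℤ._≤_ (+ t) (+ r) P
Sharp-+ (t≤r , t≡r⇔P) = ℤ.+≤+ t≤r , Equiv.trans (mk⇔ ℤₚ.+-injective (cong +_)) t≡r⇔P

triangle : ℕ → ℕ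
triangle zero    = 0
triangle (suc k) = suc k ℕ.+ triangle k

suc-C-2 : ∀ k → suc k C 2 ≡ triangle k
suc-C-2 zero    = refl
suc-C-2 (suc k) =
  trans (sym (nCk+nC[k+1]≡[n+1]C[k+1] (suc k) 1)) (cong₂ ℕ._+_ (nC1≡n (suc k)) (suc-C-2 k))

take-++ˡ : ∀ {A : Set} k (xs ys : List A) → k ℕ.≤ length xs → take k (xs ++ ys) ≡ take k xs
take-++ˡ zero    xs       ys _         = refl
take-++ˡ (suc k) (x ∷ xs) ys (ℕ.s≤s k≤) = cong (x ∷_) (take-++ˡ k xs ys k≤)

length-∷ʳ : ∀ {A : Set} (xs : List A) x → length (xs ∷ʳ x) ≡ suc (length xs)
length-∷ʳ []       x = refl
length-∷ʳ (_ ∷ xs) x = cong suc (length-∷ʳ xs x)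

sum-∷ʳ-0 : (xs : List ℕ) → sum (xs ∷ʳ 0) ≡ sum xs
sum-∷ʳ-0 xs = trans (ListActionₚ.sum-++ xs [ 0 ]) (ℕₚ.+-identityʳ (sum xs))

sum-map-suc : (xs : List ℕ) → sum (map suc xs) ≡ length xs ℕ.+ sum xs
sum-map-suc []       = refl
sum-map-suc (x ∷ xs) = trans (cong (suc x ℕ.+_) (sum-map-suc xs)) (swap x (length xs) (sum xs))
  where
    swap : ∀ a b c → suc a ℕ.+ (b ℕ.+ c) ≡ suc b ℕ.+ (a ℕ.+ c)
    swap = ℕ-Solver.solve-∀

AllPairs-∷ʳ⁺ : ∀ {A : Set} {R : A → A → Set} {xs y} →
               AllPairs R xs → All (λ x → R x y) xs → AllPairs R (xs ∷ʳ y)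
AllPairs-∷ʳ⁺ Rxs Rxsy = AllPairsₚ.++⁺ Rxs ([] ∷ []) (All.map (_∷ []) Rxsy)

descending-∷ʳ-0 : {L : List ℕ} → AllPairs ℕ._≥_ L → AllPairs ℕ._≥_ (L ∷ʳ 0)
descending-∷ʳ-0 descending = AllPairs-∷ʳ⁺ descending (All.tabulate (λ _ → ℕ.z≤n))

topSumL : List ℕ → ℕ → ℕ
topSumL M k = sum (take k M)

BrouwerAt : List ℕ → (E ω k : ℕ) → Set
BrouwerAt M E ω k = Sharp ℕ._≤_ (topSumL M k) (E ℕ.+ triangle k) (k ≡ ω)

topSumL-map-suc : ∀ k (L ys : List ℕ) → k ℕ.≤ length L →
                  topSumL (map suc L ++ ys) k ≡ k ℕ.+ topSumL (L ++ ys) k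
topSumL-map-suc zero    L       ys _          = refl
topSumL-map-suc (suc k) (l ∷ L) ys (ℕ.s≤s k≤) =
  trans (cong (suc l ℕ.+_) (topSumL-map-suc k L ys k≤)) (swap l k (topSumL (L ++ ys) k))
  where
    swap : ∀ a b c → suc a ℕ.+ (b ℕ.+ c) ≡ suc b ℕ.+ (a ℕ.+ c)
    swap = ℕ-Solver.solve-∀

topSumL-++ : (xs ys : List ℕ) → topSumL (xs ++ ys) (length xs) ≡ sum xs
topSumL-++ xs ys = cong sum (trans (take-++ˡ _ xs ys ℕₚ.≤-refl) (Listₚ.take-all _ xs ℕₚ.≤-refl))

BrouwerAt-dominating : ∀ {n E ω} (L : List ℕ) → length L ≡ n →
  (∀ k → k ℕ.< suc n → BrouwerAt (L ∷ʳ 0) E ω k) →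
  ∀ k → k ℕ.< suc (suc n) → BrouwerAt (suc (suc n) ∷ map suc L ∷ʳ 0) (suc n ℕ.+ E) (suc ω) k
BrouwerAt-dominating L refl brouwer zero    _ = Sharp-< (ℕ.s≤s ℕ.z≤n) λ ()
BrouwerAt-dominating {n} {E} L refl brouwer (suc k) (ℕ.s≤s k<) =
  Sharp-resp ℕ._≤_ top rhs (mk⇔ (cong suc) ℕₚ.suc-injective) (Sharp-+ˡ (suc (suc n) ℕ.+ k) (brouwer k k<))
  where
    top : suc (suc n) ℕ.+ k ℕ.+ topSumL (L ∷ʳ 0) k ≡ suc (suc n) ℕ.+ topSumL (map suc L ∷ʳ 0) k
    top = trans (ℕₚ.+-assoc (suc (suc n)) k _)
                (cong (suc (suc n) ℕ.+_) (sym (topSumL-map-suc k L [ 0 ] (ℕₚ.<⇒≤pred k<))))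
    rhs : suc (suc n) ℕ.+ k ℕ.+ (E ℕ.+ triangle k) ≡ suc n ℕ.+ E ℕ.+ triangle (suc k)
    rhs = regroup n k E (triangle k)
      where
        regroup : ∀ n k E t → suc (suc n) ℕ.+ k ℕ.+ (E ℕ.+ t) ≡ suc n ℕ.+ E ℕ.+ (suc k ℕ.+ t)
        regroup = ℕ-Solver.solve-∀

BrouwerAt-isolated : ∀ {n E ω} (L : List ℕ) → length L ≡ n → sum L ≡ E ℕ.+ E → ω ℕ.≤ n →
  (∀ k → k ℕ.< suc n → BrouwerAt (L ∷ʳ 0) E ω k) →
  ∀ k → k ℕ.< suc (suc n) → BrouwerAt ((L ∷ʳ 0) ∷ʳ 0) E ω k
BrouwerAt-isolated {n} {E} {ω} L refl trace ω≤n brouwer k (ℕ.s≤s k≤) with ℕₚ.m≤n⇒m<n∨m≡n k≤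
... | inj₁ k<
  = Sharp-resp ℕ._≤_ (cong sum (sym (take-++ˡ k (L ∷ʳ 0) [ 0 ] k≤′))) refl Equiv.refl (brouwer k k<)
  where
    k≤′ : k ℕ.≤ length (L ∷ʳ 0)
    k≤′ = subst (k ℕ.≤_) (sym (length-∷ʳ L 0)) (ℕₚ.<⇒≤ k<)
... | inj₂ refl = Sharp-< sum<bound λ suc-n≡ω → ℕₚ.<-irrefl (sym suc-n≡ω) (ℕ.s≤s ω≤n)
  where
    all : topSumL ((L ∷ʳ 0) ∷ʳ 0) (suc n) ≡ E ℕ.+ E
    all = begin
      topSumL ((L ∷ʳ 0) ∷ʳ 0) (suc n)         ≡⟨ cong (topSumL ((L ∷ʳ 0) ∷ʳ 0)) (sym (length-∷ʳ L 0)) ⟩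
      topSumL ((L ∷ʳ 0) ∷ʳ 0) (length (L ∷ʳ 0)) ≡⟨ topSumL-++ (L ∷ʳ 0) [ 0 ] ⟩
      sum (L ∷ʳ 0)                            ≡⟨ sum-∷ʳ-0 L ⟩
      sum L                                   ≡⟨ trace ⟩
      E ℕ.+ E                                 ∎
      where open ≡-Reasoning
    -- The old bound at k = n already reads 2E ≤ E + triangle n.
    E≤triangle : E ℕ.≤ triangle n
    E≤triangle = ℕₚ.+-cancelˡ-≤ E E (triangle n)
      (subst (ℕ._≤ E ℕ.+ triangle n) (trans (topSumL-++ L [ 0 ]) trace) (proj₁ (brouwer n ℕₚ.≤-refl)))
    sum<bound : topSumL ((L ∷ʳ 0) ∷ʳ 0) (suc n) ℕ.< E ℕ.+ triangle (suc n)
    sum<bound = subst (ℕ._< E ℕ.+ triangle (suc n)) (sym all)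
      (ℕₚ.+-monoʳ-< E (ℕ.s≤s (ℕₚ.≤-trans E≤triangle (ℕₚ.m≤n+m (triangle n) n))))

-- The spectrum of a threshold graph

eigenvalues : List (Eigenpair n) → List ℕ
eigenvalues = map proj₁

eigenvalues-extend : ∀ b (ps : List (Eigenpair n)) →
                     eigenvalues (map (extendEigenpair b) ps) ≡ map (b2n b ℕ.+_) (eigenvalues ps)
eigenvalues-extend b ps = trans (sym (Listₚ.map-∘ ps)) (Listₚ.map-∘ ps)

-- pairs, together with the all-ones vector for the eigenvalue 0, form an orthogonal eigenbasis, and
-- ω + 1 is the clique number.
record ThresholdSpectrum (n : ℕ) (e : Fin (suc n) → Bool) : Set where
  field
    pairs        : List (Eigenpair (suc n))
    length-pairs : length pairs ≡ n
    balanced     : All (IsBalancedEigenpair (RevThreshold e)) pairs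
    orthogonal   : AllPairs Orthogonal pairs
    descending   : AllPairs ℕ._≥_ (eigenvalues pairs)
    bounded      : All (ℕ._≤ suc n) (eigenvalues pairs)
    trace        : sum (eigenvalues pairs) ≡ edges (RevThreshold e) ℕ.+ edges (RevThreshold e)
    ω            : ℕ
    clique       : HasClique (RevThreshold e) (suc ω)
    no-clique    : ¬ HasClique (RevThreshold e) (suc (suc ω))
    brouwer      : ∀ k → k ℕ.< suc n → BrouwerAt (eigenvalues pairs ∷ʳ 0) (edges (RevThreshold e)) ω k

thresholdSpectrum-single : (e : Fin 1 → Bool) → ThresholdSpectrum 0 e
thresholdSpectrum-single e = record
  { pairs = [] ; length-pairs = refl ; balanced = [] ; orthogonal = [] ; descending = [] ; bounded = []
  ; trace = refl ; ω = 0
  ; clique = (λ _ → zero) , (λ { {zero} {zero} _ → refl }) , (λ { zero zero 0≢0 → ⊥-elim (0≢0 refl) })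
  ; no-clique = λ clique₂ → ℕₚ.<-irrefl refl (HasClique⇒≤ (RevThreshold e) clique₂)
  ; brouwer = λ { zero _ → ℕ.z≤n , mk⇔ (λ _ → refl) (λ _ → refl) ; (suc _) (ℕ.s≤s ()) } }

module ThresholdStep {n : ℕ} (e : Fin (suc (suc n)) → Bool) (S : ThresholdSpectrum n (e ∘ suc)) where
  open ThresholdSpectrum S

  private
    G : Graph (suc (suc n))
    G = RevThreshold e
    E : ℕ
    E = edges (RevThreshold (e ∘ suc))
    L : List ℕ
    L = eigenvalues pairs
    pivotPair : ℕ → Eigenpair (suc (suc n))
    pivotPair a = a , pivotVector (suc n)

    edges-addVertex : ∀ {b} → e zero ≡ b → edges G ≡ suc n ℕ.* b2n b ℕ.+ E
    edges-addVertex refl = cong (ℕ._+ E) (sumℕ-const (suc n) (b2n (e zero)))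

    length-L : length L ≡ n
    length-L = trans (Listₚ.length-map proj₁ pairs) length-pairs

    extended-balanced : ∀ {b} → e zero ≡ b → All (IsBalancedEigenpair G) (map (extendEigenpair b) pairs)
    extended-balanced e₀ = Allₚ.map⁺ (All.map (extendEigenpair-balanced e e₀) balanced)

    extended-orthogonal : ∀ b → AllPairs Orthogonal (map (extendEigenpair b) pairs)
    extended-orthogonal b =
      AllPairsₚ.map⁺ (AllPairs.map (λ {p} {q} p⊥q → trans (dot-extend (proj₂ p) (proj₂ q)) p⊥q) orthogonal)

    extended-⊥-pivot : ∀ b a → All (λ p → Orthogonal p (pivotPair a)) (map (extendEigenpair b) pairs)
    extended-⊥-pivot b a =
      Allₚ.map⁺ (All.map (λ {p} p-balanced → trans (dot-extend-pivot (proj₂ p)) (proj₂ p-balanced)) balanced)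

  dominating : e zero ≡ true → ThresholdSpectrum (suc n) e
  dominating e₀ = record
    { pairs        = pairs′
    ; length-pairs = cong suc (trans (Listₚ.length-map (extendEigenpair true) pairs) length-pairs)
    ; balanced     = pivot-balanced′ ∷ extended-balanced e₀
    ; orthogonal   = All.map (λ {p} → trans (dot-comm (pivotVector (suc n)) (proj₂ p)))
                             (extended-⊥-pivot true (suc (suc n)))
                     ∷ extended-orthogonal true
    ; descending   = subst (AllPairs ℕ._≥_) (sym eigenvalues′)
                       (Allₚ.map⁺ (All.map ℕ.s≤s bounded) ∷ AllPairsₚ.map⁺ (AllPairs.map ℕ.s≤s descending))
    ; bounded      = subst (All (ℕ._≤ suc (suc n))) (sym eigenvalues′)
                       (ℕₚ.≤-refl ∷ Allₚ.map⁺ (All.map ℕ.s≤s bounded))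
    ; trace        = trace′
    ; ω            = suc ω
    ; clique       = HasClique-dominating e e₀ clique
    ; no-clique    = no-clique ∘ HasClique-removeZero e
    ; brouwer      = λ k k< → subst₂ (λ M E′ → BrouwerAt (M ∷ʳ 0) E′ (suc ω) k)
                                     (sym eigenvalues′) (sym edges′)
                       (BrouwerAt-dominating L length-L brouwer k k<)
    }
    where
      pairs′ : List (Eigenpair (suc (suc n)))
      pairs′ = pivotPair (suc (suc n)) ∷ map (extendEigenpair true) pairs
      pivot-balanced′ : IsBalancedEigenpair G (pivotPair (suc (suc n)))
      pivot-balanced′ =
        subst (IsBalancedEigenpair G ∘ pivotPair) (ℕₚ.*-identityˡ (suc (suc n))) (pivot-balanced e e₀)
      eigenvalues′ : eigenvalues pairs′ ≡ suc (suc n) ∷ map suc L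
      eigenvalues′ = cong (suc (suc n) ∷_) (eigenvalues-extend true pairs)
      edges′ : edges G ≡ suc n ℕ.+ E
      edges′ = trans (edges-addVertex e₀) (cong (ℕ._+ E) (ℕₚ.*-identityʳ (suc n)))
      trace′ : sum (eigenvalues pairs′) ≡ edges G ℕ.+ edges G
      trace′ = begin
        sum (eigenvalues pairs′)               ≡⟨ cong sum eigenvalues′ ⟩
        suc (suc n) ℕ.+ sum (map suc L)        ≡⟨ cong (suc (suc n) ℕ.+_) (sum-map-suc L) ⟩
        suc (suc n) ℕ.+ (length L ℕ.+ sum L)   ≡⟨ cong₂ (λ l t → suc (suc n) ℕ.+ (l ℕ.+ t)) length-L trace ⟩
        suc (suc n) ℕ.+ (n ℕ.+ (E ℕ.+ E))      ≡⟨ regroup n E ⟩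
        (suc n ℕ.+ E) ℕ.+ (suc n ℕ.+ E)        ≡⟨ sym (cong₂ ℕ._+_ edges′ edges′) ⟩
        edges G ℕ.+ edges G                    ∎
        where
          open ≡-Reasoning
          regroup : ∀ n E → suc (suc n) ℕ.+ (n ℕ.+ (E ℕ.+ E)) ≡ (suc n ℕ.+ E) ℕ.+ (suc n ℕ.+ E)
          regroup = ℕ-Solver.solve-∀

  isolated : e zero ≡ false → ThresholdSpectrum (suc n) e
  isolated e₀ = record
    { pairs        = pairs′
    ; length-pairs = trans (length-∷ʳ (map (extendEigenpair false) pairs) (pivotPair 0))
                           (cong suc (trans (Listₚ.length-map (extendEigenpair false) pairs) length-pairs))
    ; balanced     = Allₚ.∷ʳ⁺ (extended-balanced e₀) (pivot-balanced e e₀)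
    ; orthogonal   = AllPairs-∷ʳ⁺ (extended-orthogonal false) (extended-⊥-pivot false 0)
    ; descending   = subst (AllPairs ℕ._≥_) (sym eigenvalues′) (descending-∷ʳ-0 descending)
    ; bounded      = subst (All (ℕ._≤ suc (suc n))) (sym eigenvalues′)
                       (Allₚ.∷ʳ⁺ (All.map ℕₚ.m≤n⇒m≤1+n bounded) ℕ.z≤n)
    ; trace        = trans (cong sum eigenvalues′)
                       (trans (sum-∷ʳ-0 L) (trans trace (sym (cong₂ ℕ._+_ edges′ edges′))))
    ; ω            = ω
    ; clique       = HasClique-tail e clique
    ; no-clique    = no-clique ∘ HasClique-isolated e e₀
    ; brouwer      = λ k k< → subst₂ (λ M E′ → BrouwerAt (M ∷ʳ 0) E′ ω k) (sym eigenvalues′) (sym edges′)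
                       (BrouwerAt-isolated L length-L trace ω≤n brouwer k k<)
    }
    where
      pairs′ : List (Eigenpair (suc (suc n)))
      pairs′ = map (extendEigenpair false) pairs ∷ʳ pivotPair 0
      eigenvalues′ : eigenvalues pairs′ ≡ L ∷ʳ 0
      eigenvalues′ = trans (Listₚ.map-++ proj₁ (map (extendEigenpair false) pairs) [ pivotPair 0 ])
                           (cong (_∷ʳ 0) (trans (eigenvalues-extend false pairs) (Listₚ.map-id L)))
      edges′ : edges G ≡ E
      edges′ = trans (edges-addVertex e₀) (cong (ℕ._+ E) (ℕₚ.*-zeroʳ (suc n)))
      ω≤n : ω ℕ.≤ n
      ω≤n = ℕₚ.≤-pred (HasClique⇒≤ (RevThreshold (e ∘ suc)) clique)

  step : ThresholdSpectrum (suc n) e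
  step with e zero in e₀
  ... | true  = dominating e₀
  ... | false = isolated e₀

thresholdSpectrum : ∀ n (e : Fin (suc n) → Bool) → ThresholdSpectrum n e
thresholdSpectrum zero    e = thresholdSpectrum-single e
thresholdSpectrum (suc n) e = ThresholdStep.step e (thresholdSpectrum n (e ∘ suc))

nth : {A : Set} → List A → ℕ → A → A
nth []       _       d = d
nth (x ∷ xs) zero    d = x
nth (x ∷ xs) (suc i) d = nth xs i d

All-nth : ∀ {A : Set} {P : A → Set} {xs} → All P xs → ∀ {i} d → i ℕ.< length xs → P (nth xs i d)
All-nth (px ∷ _)   {zero}  d _           = px
All-nth (_ ∷ pxs)  {suc i} d (ℕ.s≤s i<) = All-nth pxs d i<

AllPairs-nth : ∀ {A : Set} {R : A → A → Set} {xs} → AllPairs R xs →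
               ∀ {i j} d → i ℕ.< j → j ℕ.< length xs → R (nth xs i d) (nth xs j d)
AllPairs-nth (Rx ∷ _)   {zero}  {suc j} d _          (ℕ.s≤s j<) = All-nth Rx d j<
AllPairs-nth (_ ∷ Rxs)  {suc i} {suc j} d (ℕ.s≤s i<j) (ℕ.s≤s j<) = AllPairs-nth Rxs d i<j j<

nth-map : ∀ {A B : Set} (f : A → B) (xs : List A) i d → nth (map f xs) i (f d) ≡ f (nth xs i d)
nth-map f []       i       d = refl
nth-map f (x ∷ xs) zero    d = refl
nth-map f (x ∷ xs) (suc i) d = nth-map f xs i d

topSum-nth : (M : List ℕ) → length M ≡ n →
             ∀ k → topSum {n} (λ i → + nth M (toℕ i) 0) k ≡ + topSumL M k
topSum-nth []      refl zero    = refl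
topSum-nth []      refl (suc k) = refl
topSum-nth (x ∷ M) refl zero    = trans (ℤₚ.+-identityˡ _) (sumℤ-zero {length M})
topSum-nth (x ∷ M) refl (suc k) =
  trans (cong (λ s → + x ℤ.+ s) (topSum-nth M refl k)) (sym (ℤₚ.pos-+ x (topSumL M k)))

IsLaplacianSpectrum-fromList : (X : Graph n) (ps : List (Eigenpair n)) (d : Eigenpair n) → length ps ≡ n →
  All (IsEigenpair X) ps → AllPairs Orthogonal ps → AllPairs ℕ._≥_ (eigenvalues ps) →
  IsLaplacianSpectrum X (λ i → + nth (eigenvalues ps) (toℕ i) (proj₁ d))
IsLaplacianSpectrum-fromList {n} X ps d length-ps eigen orthogonal descending =
  sorted , v , (λ i → proj₂ (eigen′ i)) , orthogonal′ , eigenvalue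
  where
    v : Fin n → Fin n → ℤ
    v i = proj₂ (nth ps (toℕ i) d)
    in-range : ∀ (i : Fin n) → toℕ i ℕ.< length ps
    in-range i = subst (toℕ i ℕ.<_) (sym length-ps) (Finₚ.toℕ<n i)
    eigen′ : ∀ i → IsEigenpair X (nth ps (toℕ i) d)
    eigen′ i = All-nth eigen d (in-range i)
    μ : Fin n → ℕ
    μ i = nth (eigenvalues ps) (toℕ i) (proj₁ d)
    sorted : ∀ i j → toℕ i ℕ.≤ toℕ j → + μ j ℤ.≤ + μ i
    sorted i j i≤j with ℕₚ.m≤n⇒m<n∨m≡n i≤j
    ... | inj₁ i<j  = ℤ.+≤+ (AllPairs-nth descending (proj₁ d) i<j
                               (subst (toℕ j ℕ.<_) (sym (Listₚ.length-map proj₁ ps)) (in-range j)))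
    ... | inj₂ i≡j rewrite i≡j = ℤₚ.≤-refl
    orthogonal′ : ∀ i j → i ≢ j → dot (v i) (v j) ≡ + 0
    orthogonal′ i j i≢j with ℕₚ.<-cmp (toℕ i) (toℕ j)
    ... | tri< i<j _ _ = AllPairs-nth orthogonal d i<j (in-range j)
    ... | tri≈ _ i≡j _ = ⊥-elim (i≢j (Finₚ.toℕ-injective i≡j))
    ... | tri> _ _ j<i = trans (dot-comm (v i) (v j)) (AllPairs-nth orthogonal d j<i (in-range i))
    eigenvalue : ∀ i r → matVec (laplacian X) (v i) r ≡ + μ i ℤ.* v i r
    eigenvalue i r = begin
      matVec (laplacian X) (v i) r                      ≡⟨ matVec-laplacian X (v i) r ⟩
      laplacianAction X (v i) r                         ≡⟨ proj₁ (eigen′ i) r ⟩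
      + proj₁ (nth ps (toℕ i) d) ℤ.* v i r
        ≡⟨ cong (λ a → + a ℤ.* v i r) (sym (nth-map proj₁ ps (toℕ i) d)) ⟩
      + μ i ℤ.* v i r ∎
      where open ≡-Reasoning

-- FullBrouwer with the threshold condition dropped from the equality case, which makes it
-- invariant under isomorphism.
SharpBrouwer : Graph n → (Fin n → ℤ) → Set
SharpBrouwer {n} G μ = ∀ (k : Fin n) →
  Sharp ℤ._≤_ (topSum μ (toℕ k)) (+ (edges G ℕ.+ suc (toℕ k) C 2)) (CliqueNumber G (suc (toℕ k)))

revThreshold-spectrum : (e : Fin (suc n) → Bool) →
  Σ (Fin (suc n) → ℤ) λ μ → IsLaplacianSpectrum (RevThreshold e) μ × SharpBrouwer (RevThreshold e) μ
revThreshold-spectrum {n} e = μ , spectrum , sharp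
  where
    open ThresholdSpectrum (thresholdSpectrum n e)
    G : Graph (suc n)
    G = RevThreshold e
    onesPair : Eigenpair (suc n)
    onesPair = 0 , λ _ → + 1
    basis : List (Eigenpair (suc n))
    basis = pairs ∷ʳ onesPair
    length-basis : length basis ≡ suc n
    length-basis = trans (length-∷ʳ pairs onesPair) (cong suc length-pairs)
    basis-eigenvalues : eigenvalues basis ≡ eigenvalues pairs ∷ʳ 0
    basis-eigenvalues = Listₚ.map-++ proj₁ pairs [ onesPair ]
    μ : Fin (suc n) → ℤ
    μ i = + nth (eigenvalues basis) (toℕ i) 0
    spectrum : IsLaplacianSpectrum G μ
    spectrum = IsLaplacianSpectrum-fromList G basis onesPair length-basis
      (Allₚ.∷ʳ⁺ (All.map proj₁ balanced) (ones-eigenpair G))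
      (AllPairs-∷ʳ⁺ orthogonal (All.map (λ {p} p-balanced → trans (dot-ones (proj₂ p)) (proj₂ p-balanced)) balanced))
      (subst (AllPairs ℕ._≥_) (sym basis-eigenvalues) (descending-∷ʳ-0 descending))
    cliqueNumber⇔ : ∀ k → k ≡ ω ⇔ CliqueNumber G (suc k)
    cliqueNumber⇔ k = mk⇔ (λ { refl → clique , no-clique })
                          (λ cn → ℕₚ.suc-injective (CliqueNumber-unique G cn (clique , no-clique)))
    sharp : SharpBrouwer G μ
    sharp k = Sharp-resp ℤ._≤_
      (sym (trans (topSum-nth (eigenvalues basis) (trans (Listₚ.length-map proj₁ basis) length-basis) (toℕ k))
                  (cong (λ M → + topSumL M (toℕ k)) basis-eigenvalues)))
      (cong (λ c → + (edges G ℕ.+ c)) (sym (suc-C-2 (toℕ k))))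
      (cliqueNumber⇔ (toℕ k))
      (Sharp-+ (brouwer (toℕ k) (Finₚ.toℕ<n k)))

module _ {G H : Graph n} {π : Permutation n n} (iso : IsIsomorphism G H π) where

  CliqueNumber-iso : ∀ {k} → CliqueNumber G k ⇔ CliqueNumber H k
  CliqueNumber-iso = mk⇔ (λ (has , hasn't) → HasClique-iso iso has , hasn't ∘ HasClique-iso (flip-iso iso))
                         (λ (has , hasn't) → HasClique-iso (flip-iso iso) has , hasn't ∘ HasClique-iso iso)

  SharpBrouwer-iso : ∀ {μ} → SharpBrouwer G μ → SharpBrouwer H μ
  SharpBrouwer-iso sharp k =
    Sharp-resp ℤ._≤_ refl (cong (λ m → + (m ℕ.+ suc (toℕ k) C 2)) (sym (edges-iso iso)))
               CliqueNumber-iso (sharp k)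

SharpBrouwer⇒FullBrouwer : (H : Graph n) (μ : Fin n → ℤ) →
                           IsThreshold H → SharpBrouwer H μ → FullBrouwer H μ
SharpBrouwer⇒FullBrouwer H μ threshold sharp k =
  Sharp-resp ℤ._≤_ refl refl (mk⇔ (threshold ,_) proj₂) (sharp k)

corollary4p3 : ∀ {N : ℕ} (H : Graph N) → IsThreshold H →
    Σ (Fin N → ℤ) λ μ → IsLaplacianSpectrum H μ × FullBrouwer H μ
corollary4p3 {zero}  H (() , _)
corollary4p3 {suc n} H threshold
  with e , π , iso ← IsThreshold⇒isomorphic H threshold
  with μ , spectrum , sharp ← revThreshold-spectrum e
  = μ , IsLaplacianSpectrum-iso iso spectrum ,
    SharpBrouwer⇒FullBrouwer H μ threshold (SharpBrouwer-iso iso {μ} sharp)
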